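{- For even $n\ge 2$, every centrally symmetric matching in $\mathcal{M}_n$ lies in a connected component of $\mathcal{H}_n$ that contains only centrally symmetric matchings, and this component is a tree.
   Context: Place $2n$ points equidistantly on the unit circle. $\mathcal{M}_n$ is the set of all non-crossing straight-line perfect matchings on these points. For $M\in\mathcal{M}_n$, two edges $e,f\in M$ span an empty quadrilateral if the convex hull of $e$ and $f$ contains no other edge of $M$; replacing $e,f$ by the other two edges of this quadrilateral yields another matching of $\mathcal{M}_n$ (a flip). A flip is centered if the closed quadrilateral contains the center of the circle (possibly on its boundary). $\mathcal{H}_n$ is the graph with vertex set $\mathcal{M}_n$ and an edge between two matchings if they differ by a centered flip. A matching is centrally symmetric if it is invariant under point reflection at the circle center. -}

module Defs where

open import Data.Nat using (ℕ; zero; suc; _+_; _*_; _∸_; _≤_; _<_; _≤ᵇ_)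
open import Data.Bool using (if_then_else_)
open import Data.Fin using (Fin; toℕ)
open import Data.Vec using (Vec; lookup)
open import Data.List using (List; []; _∷_; _++_; [_]; length)
open import Data.List.Relation.Unary.Unique.Propositional using (Unique)
open import Data.Product using (Σ; _×_; ∃)
open import Data.Sum using (_⊎_)
open import Data.Unit using (⊤)
open import Data.Empty using (⊥)
open import Relation.Nullary using (¬_)
open import Relation.Binary.PropositionalEquality using (_≡_; _≢_)

-- The 2n points on the unit circle are labelled 0,1,...,2n-1 in
-- counterclockwise order (point k at angle 2πk/2n).
Point : ℕ → Set
Point n = Fin (2 * n)

-- A (candidate) matching on 2n points is given by its partner map,
-- stored as a vector so that propositional equality is the right
-- notion of equality of matchings.
record Matching (n : ℕ) : Set where
  constructor mkMatching
  field
    partnerVec : Vec (Point n) (2 * n)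

partner : ∀ {n} → Matching n → Point n → Point n
partner M i = lookup (Matching.partnerVec M) i

cdist : ℕ → ℕ → ℕ → ℕ
cdist N x z = if x ≤ᵇ z then z ∸ x else (N + z) ∸ x

Between : ℕ → ℕ → ℕ → ℕ → Set
Between N x y z = (0 < cdist N x z) × (cdist N x z < cdist N x y)

Cross : (n : ℕ) → Point n → Point n → Point n → Point n → Set
Cross n a b c d =
  (Between (2 * n) (toℕ a) (toℕ b) (toℕ c) × ¬ Between (2 * n) (toℕ a) (toℕ b) (toℕ d))
  ⊎ (¬ Between (2 * n) (toℕ a) (toℕ b) (toℕ c) × Between (2 * n) (toℕ a) (toℕ b) (toℕ d))

IsPerfectMatching : ∀ {n} → Matching n → Set
IsPerfectMatching {n} M = ∀ (i : Point n) → (partner M (partner M i) ≡ i) × (partner M i ≢ i)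

NonCrossing : ∀ {n} → Matching n → Set
NonCrossing {n} M = ∀ (i j : Point n) → ¬ Cross n i (partner M i) j (partner M j)

IsNCPM : ∀ {n} → Matching n → Set
IsNCPM M = IsPerfectMatching M × NonCrossing M

CyclicOrder : (n : ℕ) → Point n → Point n → Point n → Point n → Set
CyclicOrder n a b c d =
  (0 < cdist (2 * n) (toℕ a) (toℕ b)) ×
  (cdist (2 * n) (toℕ a) (toℕ b) < cdist (2 * n) (toℕ a) (toℕ c)) ×
  (cdist (2 * n) (toℕ a) (toℕ c) < cdist (2 * n) (toℕ a) (toℕ d))

-- The edges e = {a,b}, f = {c,d} of M span the quadrilateral abcd
-- (vertices in cyclic order, e and f are two opposite sides).  It is
-- empty if no other edge of M meets it; since the edges of M are
-- pairwise non-crossing and the points are in convex position, an edge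
-- g ≠ e,f meets the quadrilateral iff it crosses side {b,c} or side {d,a}.
EmptyQuad : ∀ {n} → Matching n → Point n → Point n → Point n → Point n → Set
EmptyQuad {n} M a b c d =
  ∀ (x : Point n) → ¬ Cross n b c x (partner M x) × ¬ Cross n d a x (partner M x)

-- The closed quadrilateral abcd (inscribed, vertices in cyclic order)
-- contains the center iff every arc between consecutive vertices is at
-- most a half circle, i.e. at most n steps.
Centered : (n : ℕ) → Point n → Point n → Point n → Point n → Set
Centered n a b c d =
  (cdist (2 * n) (toℕ a) (toℕ b) ≤ n) × (cdist (2 * n) (toℕ b) (toℕ c) ≤ n) ×
  (cdist (2 * n) (toℕ c) (toℕ d) ≤ n) × (cdist (2 * n) (toℕ d) (toℕ a) ≤ n)

CenteredFlipAt : ∀ {n} → Matching n → Matching n → Point n → Point n → Point n → Point n → Set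
CenteredFlipAt {n} M M' a b c d =
  CyclicOrder n a b c d ×
  (partner M a ≡ b) × (partner M c ≡ d) ×
  EmptyQuad M a b c d ×
  Centered n a b c d ×
  (partner M' b ≡ c) × (partner M' c ≡ b) × (partner M' d ≡ a) × (partner M' a ≡ d) ×
  (∀ (x : Point n) → x ≢ a → x ≢ b → x ≢ c → x ≢ d → partner M' x ≡ partner M x)

CenteredFlip : ∀ {n} → Matching n → Matching n → Set
CenteredFlip {n} M M' = Σ (Point n) λ a → Σ (Point n) λ b → Σ (Point n) λ c → Σ (Point n) λ d →
  CenteredFlipAt M M' a b c d

H : (n : ℕ) → Matching n → Matching n → Set
H n M M' = IsNCPM M × IsNCPM M' × (CenteredFlip M M' ⊎ CenteredFlip M' M)

-- point reflection at the center: k ↦ k + n (mod 2n)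
antipode : ℕ → ℕ → ℕ
antipode n k = if n ≤ᵇ k then k ∸ n else k + n

CentrallySymmetric : ∀ {n} → Matching n → Set
CentrallySymmetric {n} M =
  ∀ (i j : Point n) → toℕ j ≡ antipode n (toℕ i) →
    toℕ (partner M j) ≡ antipode n (toℕ (partner M i))

Chain : ∀ {A : Set} → (A → A → Set) → List A → Set
Chain R [] = ⊤
Chain R (x ∷ []) = ⊤
Chain R (x ∷ y ∷ xs) = R x y × Chain R (y ∷ xs)

IsCycle : ∀ {A : Set} → (A → A → Set) → A → List A → Set
IsCycle R v ws = (2 ≤ length ws) × Unique (v ∷ ws) × Chain R (v ∷ ws ++ [ v ])

-- Measure arcs by the number of counterclockwise steps modulo 2n.  In a non-crossing perfect
-- matching the points strictly inside the arc spanned by an edge are matched among themselves, so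
-- every edge spans an odd arc; for even n no edge is a diameter.  A centered flip of a centrally
-- symmetric matching X replaces edges ab, cd whose quadrilateral contains the center; as neither
-- edge is a diameter, emptiness of abcd forces c = σ a and d = σ b.  So the flip exchanges a pair of
-- antipodal edges for another one: the result is again symmetric, and every partner changes at most
-- to its antipode.  Hence every W in the component of M satisfies W x ∈ {M x , σ (M x)}.  Now take a
-- flip v → w₁ in the component replacing ab and cd, so that v a = b and w₁ a = σ b.  If a flip of
-- some W in the component moves the partner of a, then no other edge of W crosses the diameters
-- through a and W a; as W agrees with v up to σ, this pins W down as v or w₁.  So along a cycle
-- through v → w₁ the partner of a could never return from σ b to b.

module Submission where

open import Defs
open import Data.Nat using (ℕ; _≤_)
open import Data.Nat.Divisibility using (_∣_)
open import Data.List using (_∷_)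
open import Data.List.Relation.Unary.All using (All)
open import Data.Product using (_×_)
open import Data.Empty using (⊥)
open import Relation.Binary.Construct.Closure.ReflexiveTransitive using (Star)

open import Data.Bool using (true; false; T)
open import Data.Empty using (⊥-elim)
open import Data.Fin using (toℕ; fromℕ<) renaming (_≟_ to _≟ᶠ_)
open import Data.Fin.Properties using (toℕ-injective; toℕ<n; toℕ-fromℕ<)
open import Data.List using ([]; [_]; _++_)
open import Data.List.Relation.Unary.All using ([]; _∷_)
import Data.List.Relation.Unary.All as All
open import Data.List.Relation.Unary.AllPairs.Core using (_∷_)
open import Data.Nat
open import Data.Nat.Divisibility using (divides)
open import Data.Nat.Properties
open import Algebra.Properties.CommutativeSemigroup +-commutativeSemigroup using (xy∙z≈xz∙y)
open import Data.Nat.Induction using (<-rec)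
open import Data.Nat.Tactic.RingSolver using (solve-∀)
open import Data.Product using (∃-syntax; _,_; proj₁; proj₂)
open import Function using (_∘_)
open import Data.Sum using (_⊎_; inj₁; inj₂; swap; [_,_]′) renaming (map to map⊎)
open import Data.Unit using (tt)
open import Data.Vec.Relation.Binary.Pointwise.Extensional using (ext; Pointwise-≡⇒≡)
open import Relation.Binary using (tri<; tri≈; tri>)
open import Relation.Binary.Construct.Closure.ReflexiveTransitive using (ε; _◅_)
open import Relation.Binary.PropositionalEquality hiding ([_])
open import Relation.Nullary using (¬_; yes; no; Dec)
open import Relation.Nullary.Decidable using (_×-dec_)

-- Counting steps around a circle

module CircleSteps (N : ℕ) where

  Steps : ℕ → ℕ → ℕ → Set
  Steps x k z = (x + k ≡ z) ⊎ (x + k ≡ z + N)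

  +N≮N : ∀ a → a + N ≮ N
  +N≮N a = ≤⇒≯ (m≤n+m N a)

  shiftʳ : ∀ x k l {y} → x + k ≡ y → x + (k + l) ≡ y + l
  shiftʳ x k l e = trans (sym (+-assoc x k l)) (cong (_+ l) e)

  cdist-steps : ∀ {x z} → x < N → z < N → cdist N x z < N × Steps x (cdist N x z) z
  cdist-steps {x} {z} x<N z<N with x ≤ᵇ z in eq
  ... | true = ≤-<-trans (m∸n≤m z x) z<N , inj₁ (m+[n∸m]≡n (≤ᵇ⇒≤ x z (subst T (sym eq) tt)))
  ... | false = wrapped , inj₂ (trans (m+[n∸m]≡n x≤N+z) (+-comm N z))
    where
      z<x : z < x
      z<x = ≰⇒> (λ x≤z → subst T eq (≤⇒≤ᵇ x≤z))
      x≤N+z : x ≤ N + z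
      x≤N+z = ≤-trans (<⇒≤ x<N) (m≤m+n N z)
      wrapped : N + z ∸ x < N
      wrapped = +-cancelʳ-< x (N + z ∸ x) N
                  (subst (_< N + x) (sym (m∸n+n≡m x≤N+z)) (+-monoʳ-< N z<x))

  steps-unique : ∀ {x k k' z} → k < N → k' < N → Steps x k z → Steps x k' z → k ≡ k'
  steps-unique {x} _ _ (inj₁ e) (inj₁ e') = +-cancelˡ-≡ x _ _ (trans e (sym e'))
  steps-unique {x} _ _ (inj₂ e) (inj₂ e') = +-cancelˡ-≡ x _ _ (trans e (sym e'))
  steps-unique {x} {k} {k'} _ k'<N (inj₁ e) (inj₂ e') =
    ⊥-elim (+N≮N k (subst (_< N) k'≡k+N k'<N))
    where
      k'≡k+N : k' ≡ k + N
      k'≡k+N = +-cancelˡ-≡ x k' (k + N) (trans e' (sym (shiftʳ x k N e)))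
  steps-unique k<N k'<N (inj₂ e) (inj₁ e') = sym (steps-unique k'<N k<N (inj₁ e') (inj₂ e))

  steps-deterministic : ∀ {o k x y} → x < N → y < N → Steps o k x → Steps o k y → x ≡ y
  steps-deterministic _ _ (inj₁ e) (inj₁ e') = trans (sym e) e'
  steps-deterministic _ _ (inj₂ e) (inj₂ e') = +-cancelʳ-≡ N _ _ (trans (sym e) e')
  steps-deterministic {y = y} x<N _ (inj₁ e) (inj₂ e') =
    ⊥-elim (+N≮N y (subst (_< N) (trans (sym e) e') x<N))
  steps-deterministic {o} {k} x<N y<N (inj₂ e) (inj₁ e') =
    sym (steps-deterministic {o} {k} y<N x<N (inj₁ e') (inj₂ e))

  steps-injective : ∀ {y y' k x} → y < N → y' < N → Steps y k x → Steps y' k x → y ≡ y'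
  steps-injective {k = k} _ _ (inj₁ e) (inj₁ e') = +-cancelʳ-≡ k _ _ (trans e (sym e'))
  steps-injective {k = k} _ _ (inj₂ e) (inj₂ e') = +-cancelʳ-≡ k _ _ (trans e (sym e'))
  steps-injective {y} {y'} {k} _ y'<N (inj₁ e) (inj₂ e') = ⊥-elim (+N≮N y (subst (_< N) y'≡y+N y'<N))
    where
      y'≡y+N : y' ≡ y + N
      y'≡y+N = +-cancelʳ-≡ k y' (y + N) (trans e' (trans (cong (_+ N) (sym e)) (xy∙z≈xz∙y y k N)))
  steps-injective y<N y'<N (inj₂ e) (inj₁ e') = sym (steps-injective y'<N y<N (inj₁ e') (inj₂ e))

  steps-+ : ∀ {x k y l z} → x < N → Steps x k y → Steps y l z → k + l < N → Steps x (k + l) z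
  steps-+ {x} {k} {l = l} _ (inj₁ e) (inj₁ e') _ = inj₁ (trans (shiftʳ x k l e) e')
  steps-+ {x} {k} {l = l} _ (inj₁ e) (inj₂ e') _ = inj₂ (trans (shiftʳ x k l e) e')
  steps-+ {x} {k} {y} {l} _ (inj₂ e) (inj₁ e') _ =
    inj₂ (trans (shiftʳ x k l e) (trans (xy∙z≈xz∙y y N l) (cong (_+ N) e')))
  steps-+ {x} {k} {y} {l} {z} x<N (inj₂ e) (inj₂ e') k+l<N =
    ⊥-elim (<⇒≱ (+-mono-< x<N k+l<N) 2N≤)
    where
      2N≤ : N + N ≤ x + (k + l)
      2N≤ = begin
        N + N         ≤⟨ m≤n+m (N + N) z ⟩
        z + (N + N)   ≡⟨ +-assoc z N N ⟨
        z + N + N     ≡⟨ cong (_+ N) e' ⟨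
        y + l + N     ≡⟨ xy∙z≈xz∙y y N l ⟨
        y + N + l     ≡⟨ shiftʳ x k l e ⟨
        x + (k + l)   ∎
        where open ≤-Reasoning

  steps-cancelˡ : ∀ {o k p m x} → x < N → Steps o k p → Steps o (k + m) x → Steps p m x
  steps-cancelˡ {o} {k} {m = m} _ (inj₁ e) (inj₁ e') = inj₁ (trans (sym (shiftʳ o k m e)) e')
  steps-cancelˡ {o} {k} {m = m} _ (inj₁ e) (inj₂ e') = inj₂ (trans (sym (shiftʳ o k m e)) e')
  steps-cancelˡ {o} {k} {p} {m} x<N (inj₂ e) (inj₁ e') =
    ⊥-elim (+N≮N (p + m) (subst (_< N) (trans (sym e') (trans (shiftʳ o k m e) (xy∙z≈xz∙y p N m))) x<N))
  steps-cancelˡ {o} {k} {p} {m} _ (inj₂ e) (inj₂ e') =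
    inj₁ (+-cancelʳ-≡ N _ _ (trans (sym (xy∙z≈xz∙y p N m)) (trans (sym (shiftʳ o k m e)) e')))

  steps-reverse : ∀ {o k p m} → Steps o k p → k + m ≡ N → Steps p m o
  steps-reverse {o} {k} {m = m} (inj₁ e) k+m≡N = inj₂ (trans (sym (shiftʳ o k m e)) (cong (o +_) k+m≡N))
  steps-reverse {o} {k} {p} {m} (inj₂ e) k+m≡N =
    inj₁ (+-cancelʳ-≡ N _ _ (trans (sym (xy∙z≈xz∙y p N m)) (trans (sym (shiftʳ o k m e)) (cong (o +_) k+m≡N))))

Odd : ℕ → Set
Odd k = ∃[ m ] k ≡ suc (m + m)

odd+odd+1 : ∀ {k l} → Odd k → Odd l → Odd (suc (k + l))
odd+odd+1 {k} {l} (a , k≡) (b , l≡) = suc (a + b) , trans (cong suc (cong₂ _+_ k≡ l≡)) (regroup a b)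
  where
    regroup : ∀ a b → suc (suc (a + a) + suc (b + b)) ≡ suc (suc (a + b) + suc (a + b))
    regroup = solve-∀

odd⇒¬2∣ : ∀ {k} → Odd k → ¬ 2 ∣ k
odd⇒¬2∣ (m , refl) (divides q e) = odd≢even m q e
  where
    odd≢even : ∀ m q → suc (m + m) ≢ q * 2
    odd≢even m       zero          ()
    odd≢even zero    (suc zero)    ()
    odd≢even zero    (suc (suc q)) ()
    odd≢even (suc m) (suc q)       e = odd≢even m q (trans (sym (+-suc m m)) (suc-injective (suc-injective e)))

module Circle (n : ℕ) (1≤n : 1 ≤ n) where

  N : ℕ
  N = 2 * n

  open CircleSteps N public

  N≡n+n : N ≡ n + n
  N≡n+n = cong (n +_) (+-identityʳ n)

  n<N : n < N
  n<N = subst (n <_) (sym N≡n+n) (m<m+n n 1≤n)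

  Pt : Set
  Pt = Point n

  arc : Pt → Pt → ℕ
  arc p q = cdist N (toℕ p) (toℕ q)

  arc<N : ∀ p q → arc p q < N
  arc<N p q = proj₁ (cdist-steps (toℕ<n p) (toℕ<n q))

  arc-steps : ∀ p q → Steps (toℕ p) (arc p q) (toℕ q)
  arc-steps p q = proj₂ (cdist-steps (toℕ<n p) (toℕ<n q))

  arc-unique : ∀ p q {k} → k < N → Steps (toℕ p) k (toℕ q) → arc p q ≡ k
  arc-unique p q k<N s = steps-unique (arc<N p q) k<N (arc-steps p q) s

  arc-injective : ∀ o {x y} → arc o x ≡ arc o y → x ≡ y
  arc-injective o {x} {y} e = toℕ-injective
    (steps-deterministic {toℕ o} {arc o x} (toℕ<n x) (toℕ<n y) (arc-steps o x)
      (subst (λ k → Steps (toℕ o) k (toℕ y)) (sym e) (arc-steps o y)))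

  arc-self : ∀ o → arc o o ≡ 0
  arc-self o = arc-unique o o (≤-trans (s≤s z≤n) n<N) (inj₁ (+-identityʳ (toℕ o)))

  arc>0 : ∀ o {x} → x ≢ o → 0 < arc o x
  arc>0 o x≢o = n≢0⇒n>0 (λ e → x≢o (arc-injective o (trans e (sym (arc-self o)))))

  point-at : ∀ o k → k < N → ∃[ t ] arc o t ≡ k
  point-at o k k<N with toℕ o + k <? N
  ... | yes o+k<N = fromℕ< o+k<N , arc-unique o _ k<N (inj₁ (sym (toℕ-fromℕ< o+k<N)))
  ... | no o+k≮N = fromℕ< t<N , arc-unique o _ k<N
                     (inj₂ (trans (sym (m∸n+n≡m N≤o+k)) (cong (_+ N) (sym (toℕ-fromℕ< t<N)))))
    where
      N≤o+k : N ≤ toℕ o + k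
      N≤o+k = ≮⇒≥ o+k≮N
      t<N : toℕ o + k ∸ N < N
      t<N = +-cancelʳ-< N _ N (subst (_< N + N) (sym (m∸n+n≡m N≤o+k)) (+-mono-< (toℕ<n o) k<N))

  arc-+ : ∀ o p x → arc o p + arc p x < N → arc o x ≡ arc o p + arc p x
  arc-+ o p x lt =
    arc-unique o x lt (steps-+ {k = arc o p} {y = toℕ p} (toℕ<n o) (arc-steps o p) (arc-steps p x) lt)

  arc-split : ∀ o p x → arc o p ≤ arc o x → arc o p + arc p x ≡ arc o x
  arc-split o p x le = trans (cong (arc o p +_) arc-px) (m+[n∸m]≡n le)
    where
      steps-ox : Steps (toℕ o) (arc o p + (arc o x ∸ arc o p)) (toℕ x)
      steps-ox = subst (λ k → Steps (toℕ o) k (toℕ x)) (sym (m+[n∸m]≡n le)) (arc-steps o x)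
      arc-px : arc p x ≡ arc o x ∸ arc o p
      arc-px = arc-unique p x (≤-<-trans (m∸n≤m (arc o x) (arc o p)) (arc<N o x))
                 (steps-cancelˡ {toℕ o} {arc o p} (toℕ<n x) (arc-steps o p) steps-ox)

  arc-wrap : ∀ o p x → arc o x < arc o p → arc o p + arc p x ≡ N + arc o x
  arc-wrap o p x lt = trans (cong (arc o p +_) arc-px) (go-around (arc o x))
    where
      op≤N : arc o p ≤ N
      op≤N = <⇒≤ (arc<N o p)
      go-around : ∀ m → arc o p + (N ∸ arc o p + m) ≡ N + m
      go-around m = trans (sym (+-assoc (arc o p) _ m)) (cong (_+ m) (m+[n∸m]≡n op≤N))
      back<N : N ∸ arc o p + arc o x < N
      back<N = +-cancelˡ-< (arc o p) _ N
                 (subst₂ _<_ (sym (go-around (arc o x))) (+-comm N (arc o p)) (+-monoʳ-< N lt))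
      arc-px : arc p x ≡ N ∸ arc o p + arc o x
      arc-px = arc-unique p x back<N
                 (steps-+ {k = N ∸ arc o p} {y = toℕ o} (toℕ<n p)
                   (steps-reverse {k = arc o p} (arc-steps o p) (m+[n∸m]≡n op≤N)) (arc-steps o x) back<N)

  arc-round-trip : ∀ o p → 0 < arc o p → arc o p + arc p o ≡ N
  arc-round-trip o p op>0 = begin
    arc o p + arc p o  ≡⟨ arc-wrap o p o (subst (_< arc o p) (sym (arc-self o)) op>0) ⟩
    N + arc o o        ≡⟨ cong (N +_) (arc-self o) ⟩
    N + 0              ≡⟨ +-identityʳ N ⟩
    N                  ∎
    where open ≡-Reasoning

  antipode<N : ∀ {k} → k < N → antipode n k < N
  antipode<N {k} k<N with n ≤ᵇ k in eq
  ... | true = ≤-<-trans (m∸n≤m k n) k<N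
  ... | false = subst (k + n <_) (sym N≡n+n) (+-monoˡ-< n (≰⇒> (λ n≤k → subst T eq (≤⇒≤ᵇ n≤k))))

  steps-antipode : ∀ k → Steps k n (antipode n k)
  steps-antipode k with n ≤ᵇ k in eq
  ... | false = inj₁ refl
  ... | true = inj₂ (begin
        k + n            ≡⟨ cong (_+ n) (m∸n+n≡m n≤k) ⟨
        k ∸ n + n + n    ≡⟨ +-assoc (k ∸ n) n n ⟩
        k ∸ n + (n + n)  ≡⟨ cong (k ∸ n +_) N≡n+n ⟨
        k ∸ n + N        ∎)
    where
      open ≡-Reasoning
      n≤k : n ≤ k
      n≤k = ≤ᵇ⇒≤ n k (subst T (sym eq) tt)

  σ : Pt → Pt
  σ p = fromℕ< (antipode<N (toℕ<n p))

  toℕ-σ : ∀ p → toℕ (σ p) ≡ antipode n (toℕ p)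
  toℕ-σ p = toℕ-fromℕ< (antipode<N (toℕ<n p))

  steps-σ : ∀ p → Steps (toℕ p) n (toℕ (σ p))
  steps-σ p = subst (Steps (toℕ p) n) (sym (toℕ-σ p)) (steps-antipode (toℕ p))

  steps-σ⁻¹ : ∀ p → Steps (toℕ (σ p)) n (toℕ p)
  steps-σ⁻¹ p = steps-reverse {k = n} (steps-σ p) (sym N≡n+n)

  arc-σ : ∀ p → arc p (σ p) ≡ n
  arc-σ p = arc-unique p (σ p) n<N (steps-σ p)

  σ-involutive : ∀ p → σ (σ p) ≡ p
  σ-involutive p = toℕ-injective
    (steps-deterministic {toℕ (σ p)} {n} (toℕ<n (σ (σ p))) (toℕ<n p) (steps-σ (σ p)) (steps-σ⁻¹ p))

  σ-injective : ∀ {p q} → σ p ≡ σ q → p ≡ q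
  σ-injective {p} {q} e = trans (sym (σ-involutive p)) (trans (cong σ e) (σ-involutive q))

  σ-irreflexive : ∀ p → σ p ≢ p
  σ-irreflexive p e = <-irrefl (sym (trans (sym (arc-σ p)) (trans (cong (arc p) e) (arc-self p)))) 1≤n

  arc-σ-< : ∀ o x → arc o x < n → arc o (σ x) ≡ arc o x + n
  arc-σ-< o x lt = arc-unique o (σ x) sum<N (steps-+ {k = arc o x} (toℕ<n o) (arc-steps o x) (steps-σ x) sum<N)
    where
      sum<N : arc o x + n < N
      sum<N = subst (arc o x + n <_) (sym N≡n+n) (+-monoˡ-< n lt)

  arc-σ-≥ : ∀ o x → n ≤ arc o x → arc o (σ x) + n ≡ arc o x
  arc-σ-≥ o x le = trans (cong (λ t → arc o t + n) (sym y≡σx)) ot+n≡ox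
    where
      y-spec : ∃[ y ] arc o y ≡ arc o x ∸ n
      y-spec = point-at o (arc o x ∸ n) (≤-<-trans (m∸n≤m (arc o x) n) (arc<N o x))
      y : Pt
      y = proj₁ y-spec
      ot+n≡ox : arc o y + n ≡ arc o x
      ot+n≡ox = trans (cong (_+ n) (proj₂ y-spec)) (m∸n+n≡m le)
      steps-ox : Steps (toℕ o) (arc o y + n) (toℕ x)
      steps-ox = subst (λ k → Steps (toℕ o) k (toℕ x)) (sym ot+n≡ox) (arc-steps o x)
      y≡σx : y ≡ σ x
      y≡σx = toℕ-injective (steps-injective (toℕ<n y) (toℕ<n (σ x))
               (steps-cancelˡ {toℕ o} {arc o y} (toℕ<n x) (arc-steps o y) steps-ox) (steps-σ⁻¹ x))

  Inside : Pt → Pt → Pt → Set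
  Inside p q x = Between N (toℕ p) (toℕ q) (toℕ x)

  inside? : ∀ p q x → Dec (Inside p q x)
  inside? p q x = (0 <? arc p x) ×-dec (arc p x <? arc p q)

  ¬cross-inside : ∀ p q x y → ¬ Cross n p q x y → Inside p q x → Inside p q y
  ¬cross-inside p q x y ¬cross inside-x with inside? p q y
  ... | yes inside-y = inside-y
  ... | no outside-y = ⊥-elim (¬cross (inj₁ (inside-x , outside-y)))

  arc>0-beyond : ∀ o p x → arc o p < arc o x → 0 < arc p x
  arc>0-beyond o p x px =
    +-cancelˡ-< (arc o p) 0 _ (subst₂ _<_ (sym (+-identityʳ _)) (sym (arc-split o p x (<⇒≤ px))) px)

  inside⇒arc-between : ∀ o p q x → arc o p < arc o q → Inside p q x →
                       arc o p < arc o x × arc o x < arc o q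
  inside⇒arc-between o p q x pq (px>0 , px<pq) with ≤-<-connex (arc o p) (arc o x)
  ... | inj₁ le = subst (arc o p <_) (arc-split o p x le) (m<m+n (arc o p) px>0)
                , subst₂ _<_ (arc-split o p x le) (arc-split o p q (<⇒≤ pq)) (+-monoʳ-< (arc o p) px<pq)
  ... | inj₂ lt = ⊥-elim (<⇒≱ N+ox<N (m≤m+n N (arc o x)))
    where
      N+ox<N : N + arc o x < N
      N+ox<N = <-trans (subst₂ _<_ (arc-wrap o p x lt) (arc-split o p q (<⇒≤ pq))
                          (+-monoʳ-< (arc o p) px<pq))
                        (arc<N o q)

  arc-between⇒inside : ∀ o p q x → arc o p < arc o q → arc o p < arc o x → arc o x < arc o q →
                       Inside p q x
  arc-between⇒inside o p q x pq px xq =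
    arc>0-beyond o p x px ,
    +-cancelˡ-< (arc o p) _ _ (subst₂ _<_ (sym op+px) (sym (arc-split o p q (<⇒≤ pq))) xq)
    where
      op+px : arc o p + arc p x ≡ arc o x
      op+px = arc-split o p x (<⇒≤ px)

  inside-toward⇒arc-beyond : ∀ o p x → 0 < arc o p → Inside p o x → arc o p < arc o x
  inside-toward⇒arc-beyond o p x op>0 (px>0 , px<po) with ≤-<-connex (arc o p) (arc o x)
  ... | inj₁ le = subst (arc o p <_) (arc-split o p x le) (m<m+n (arc o p) px>0)
  ... | inj₂ lt = ⊥-elim (<⇒≱ (subst₂ _<_ (arc-wrap o p x lt) (arc-round-trip o p op>0)
                                  (+-monoʳ-< (arc o p) px<po))
                               (m≤m+n N (arc o x)))

  arc-beyond⇒inside-toward : ∀ o p x → 0 < arc o p → arc o p < arc o x → Inside p o x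
  arc-beyond⇒inside-toward o p x op>0 px =
    arc>0-beyond o p x px ,
    +-cancelˡ-< (arc o p) _ _ (subst₂ _<_ (sym op+px) (sym (arc-round-trip o p op>0)) (arc<N o x))
    where
      op+px : arc o p + arc p x ≡ arc o x
      op+px = arc-split o p x (<⇒≤ px)

  Half : Pt → Pt → Set
  Half p = Inside p (σ p)

  half⇒arc<n : ∀ p z → Half p z → arc p z < n
  half⇒arc<n p z (_ , pz<n) = subst (arc p z <_) (arc-σ p) pz<n

  arc⇒half : ∀ p z → 0 < arc p z → arc p z < n → Half p z
  arc⇒half p z pz>0 pz<n = pz>0 , subst (arc p z <_) (sym (arc-σ p)) pz<n

  arc⇒half-σ : ∀ p z → n < arc p z → Half (σ p) z
  arc⇒half-σ p z n<pz = subst (λ q → Inside (σ p) q z) (sym (σ-involutive p))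
    (arc-beyond⇒inside-toward p (σ p) z (subst (0 <_) (sym (arc-σ p)) 1≤n)
      (subst (_< arc p z) (sym (arc-σ p)) n<pz))

  half-σ⇒arc : ∀ p z → Half (σ p) z → n < arc p z
  half-σ⇒arc p z h = subst (_< arc p z) (arc-σ p)
    (inside-toward⇒arc-beyond p (σ p) z (subst (0 <_) (sym (arc-σ p)) 1≤n)
      (subst (λ q → Inside (σ p) q z) (σ-involutive p) h))

  ¬half⇒n<arc : ∀ p z → z ≢ p → z ≢ σ p → ¬ Half p z → n < arc p z
  ¬half⇒n<arc p z z≢p z≢σp ¬half with <-cmp (arc p z) n
  ... | tri< lt _ _ = ⊥-elim (¬half (arc⇒half p z (arc>0 p z≢p) lt))
  ... | tri≈ _ e _ = ⊥-elim (z≢σp (arc-injective p (trans e (sym (arc-σ p)))))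
  ... | tri> _ _ gt = gt

  ¬half⇒half-σ : ∀ p z → z ≢ p → z ≢ σ p → ¬ Half p z → Half (σ p) z
  ¬half⇒half-σ p z z≢p z≢σp ¬half = arc⇒half-σ p z (¬half⇒n<arc p z z≢p z≢σp ¬half)

  half⇒¬half-σ : ∀ p z → Half p z → ¬ Half (σ p) z
  half⇒¬half-σ p z h h' = <-asym (half⇒arc<n p z h) (half-σ⇒arc p z h')

  half⇒¬half-antipode : ∀ p y → Half p y → ¬ Half p (σ y)
  half⇒¬half-antipode p y h h' = <⇒≱ (half⇒arc<n p (σ y) h')
    (subst (n ≤_) (sym (arc-σ-< p y (half⇒arc<n p y h))) (m≤n+m n (arc p y)))

  ¬half⇒half-antipode : ∀ p y → y ≢ p → y ≢ σ p → ¬ Half p y → Half p (σ y)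
  ¬half⇒half-antipode p y y≢p y≢σp ¬half = arc⇒half p (σ y) pσy>0 pσy<n
    where
      n<py : n < arc p y
      n<py = ¬half⇒n<arc p y y≢p y≢σp ¬half
      pσy+n≡py : arc p (σ y) + n ≡ arc p y
      pσy+n≡py = arc-σ-≥ p y (<⇒≤ n<py)
      pσy>0 : 0 < arc p (σ y)
      pσy>0 = n≢0⇒n>0 (λ e → <-irrefl (sym (trans (sym pσy+n≡py) (cong (_+ n) e))) n<py)
      pσy<n : arc p (σ y) < n
      pσy<n = +-cancelʳ-< n (arc p (σ y)) n (subst₂ _<_ (sym pσy+n≡py) N≡n+n (arc<N p y))

  SameSide : Pt → Pt → Pt → Set
  SameSide p x y = (Half p x → Half p y) × (Half p y → Half p x)

  sameSide-σ : ∀ p x y → x ≢ p → x ≢ σ p → y ≢ p → y ≢ σ p → SameSide p x y → SameSide (σ p) x y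
  sameSide-σ p x y x≢p x≢σp y≢p y≢σp (x⇒y , y⇒x) =
    (λ hx → ¬half⇒half-σ p y y≢p y≢σp (λ hy → half⇒¬half-σ p x (y⇒x hy) hx)) ,
    (λ hy → ¬half⇒half-σ p x x≢p x≢σp (λ hx → half⇒¬half-σ p y (x⇒y hx) hy))

  ¬sameSide-antipodes : ∀ p x y → y ≢ p → y ≢ σ p → SameSide p x y → ¬ SameSide p x (σ y)
  ¬sameSide-antipodes p x y y≢p y≢σp (x⇒y , y⇒x) (x⇒σy , σy⇒x) with inside? p (σ p) y
  ... | yes hy = half⇒¬half-antipode p y hy (x⇒σy (y⇒x hy))
  ... | no ¬hy = ¬hy (x⇒y (σy⇒x (¬half⇒half-antipode p y y≢p y≢σp ¬hy)))

  -- Edges of a non-crossing perfect matching span odd arcs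

  module NonCrossingPerfectMatching (M : Matching n) (isNCPM : IsNCPM M) where

    private
      m : Pt → Pt
      m = partner M

    involutive : ∀ i → m (m i) ≡ i
    involutive i = proj₁ (proj₁ isNCPM i)

    fixpoint-free : ∀ i → m i ≢ i
    fixpoint-free i = proj₂ (proj₁ isNCPM i)

    non-crossing : ∀ i j → ¬ Cross n i (m i) j (m j)
    non-crossing = proj₂ isNCPM

    MatchedWithin : Pt → ℕ → Set
    MatchedWithin x k = ∀ q → 0 < arc x q → arc x q < k → 0 < arc x (m q) × arc x (m q) < k

    module Sweep (x : Pt) (shorter-odd : ∀ t → arc t (m t) < arc x (m x) → Odd (arc t (m t))) where

      L : ℕ
      L = arc x (m x)

      -- The point t at offset k is matched to a point w inside the arc of x beyond k; the edge tw is
      -- shorter than the edge at x, so it spans an odd arc, and the matched block grows to the odd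
      -- length arc x w + 1.
      module Step (k : ℕ) (k≥1 : 1 ≤ k) (k<L : k < L) (matched : MatchedWithin x k) where

        t-spec : ∃[ t ] arc x t ≡ k
        t-spec = point-at x k (<-trans k<L (arc<N x (m x)))

        t : Pt
        t = proj₁ t-spec

        xt≡k : arc x t ≡ k
        xt≡k = proj₂ t-spec

        xt>0 : 0 < arc x t
        xt>0 = subst (0 <_) (sym xt≡k) k≥1

        w : Pt
        w = m t

        w-inside : Inside x (m x) w
        w-inside = ¬cross-inside x (m x) t w (non-crossing x t) (xt>0 , subst (_< L) (sym xt≡k) k<L)

        k≤xw : k ≤ arc x w
        k≤xw with ≤-<-connex k (arc x w)
        ... | inj₁ le = le
        ... | inj₂ xw<k = ⊥-elim (<-irrefl (trans (cong (arc x) (involutive t)) xt≡k)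
                                            (proj₂ (matched w (proj₁ w-inside) xw<k)))

        k<xw : k < arc x w
        k<xw = ≤∧≢⇒< k≤xw (λ e → fixpoint-free t (arc-injective x (trans (sym e) (sym xt≡k))))

        xt<xw : arc x t < arc x w
        xt<xw = subst (_< arc x w) (sym xt≡k) k<xw

        k+tw≡xw : k + arc t w ≡ arc x w
        k+tw≡xw = subst (λ z → z + arc t w ≡ arc x w) xt≡k (arc-split x t w (<⇒≤ xt<xw))

        tw<L : arc t w < L
        tw<L = ≤-<-trans (subst (arc t w ≤_) k+tw≡xw (m≤n+m _ k)) (proj₂ w-inside)

        matched-beyond : MatchedWithin x (suc (arc x w))
        matched-beyond q xq>0 xq≤xw with <-cmp (arc x q) k
        ... | tri< xq<k _ _ = let (p>0 , p<k) = matched q xq>0 xq<k in p>0 , <-trans p<k (s≤s k≤xw)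
        ... | tri≈ _ xq≡k _ rewrite arc-injective x (trans xq≡k (sym xt≡k)) = proj₁ w-inside , ≤-refl
        ... | tri> _ _ k<xq with arc x q ≟ arc x w
        ...   | yes xq≡xw rewrite arc-injective x xq≡xw | involutive t =
                  xt>0 , subst (_< suc (arc x w)) (sym xt≡k) (<⇒≤ (s≤s k<xw))
        ...   | no xq≢xw =
                  let q-inside = arc-between⇒inside x t w q xt<xw (subst (_< arc x q) (sym xt≡k) k<xq)
                                   (≤∧≢⇒< (s≤s⁻¹ xq≤xw) xq≢xw)
                      (t<mq , mq<w) = inside⇒arc-between x t w (m q) xt<xw
                                        (¬cross-inside t w q (m q) (non-crossing t q) q-inside)
                  in <-≤-trans xt>0 (<⇒≤ t<mq) , <-trans mq<w ≤-refl

      extend : ∀ k → 1 ≤ k → k < L → Odd k → MatchedWithin x k →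
               ∃[ k' ] k < k' × k' ≤ L × Odd k' × MatchedWithin x k'
      extend k k≥1 k<L odd-k matched =
        suc (arc x w) , s≤s k≤xw , proj₂ w-inside ,
        subst (λ z → Odd (suc z)) k+tw≡xw (odd+odd+1 odd-k (shorter-odd t tw<L)) , matched-beyond
        where open Step k k≥1 k<L matched

      sweep : ∀ f k → L < f + k → 1 ≤ k → k ≤ L → Odd k → MatchedWithin x k → Odd L
      sweep f k L<f+k k≥1 k≤L odd-k matched with k ≟ L
      ... | yes k≡L = subst Odd k≡L odd-k
      ... | no k≢L = continue f L<f+k (extend k k≥1 (≤∧≢⇒< k≤L k≢L) odd-k matched)
        where
          continue : ∀ f → L < f + k → (∃[ k' ] k < k' × k' ≤ L × Odd k' × MatchedWithin x k') → Odd L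
          continue zero L<k _ = ⊥-elim (<⇒≱ L<k k≤L)
          continue (suc f) L<f+k (k' , k<k' , k'≤L , odd-k' , matched') =
            sweep f k' (<-≤-trans L<f+k (subst (_≤ f + k') (+-suc f k) (+-monoʳ-≤ f k<k')))
                  (≤-trans k≥1 (<⇒≤ k<k')) k'≤L odd-k' matched'

      edge-odd : Odd L
      edge-odd = sweep L 1 (m<m+n L ≤-refl) ≤-refl
                   (arc>0 x (fixpoint-free x)) (0 , refl) (λ q q>0 q<1 → ⊥-elim (<⇒≱ q>0 (s≤s⁻¹ q<1)))

    edge-odd : ∀ x → Odd (arc x (m x))
    edge-odd x = <-rec OddEdges shorter⇒odd (arc x (m x)) x refl
      where
        OddEdges : ℕ → Set
        OddEdges L = ∀ x → arc x (m x) ≡ L → Odd L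
        shorter⇒odd : ∀ L → (∀ {L'} → L' < L → OddEdges L') → OddEdges L
        shorter⇒odd _ rec x refl = Sweep.edge-odd x (λ t lt → rec lt t refl)

    no-diameter : 2 ∣ n → ∀ x → arc x (m x) ≢ n
    no-diameter 2∣n x e = odd⇒¬2∣ (subst Odd e (edge-odd x)) 2∣n

  -- Centered flips

  Avoids : Pt → Pt → Pt → Pt → Pt → Set
  Avoids a b c d x = (x ≢ a) × (x ≢ b) × (x ≢ c) × (x ≢ d)

  Corner : Pt → Pt → Pt → Pt → Pt → Set
  Corner a b c d x = (x ≡ a) ⊎ (x ≡ b) ⊎ (x ≡ c) ⊎ (x ≡ d)

  corner? : ∀ a b c d x → Corner a b c d x ⊎ Avoids a b c d x
  corner? a b c d x with x ≟ᶠ a | x ≟ᶠ b | x ≟ᶠ c | x ≟ᶠ d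
  ... | yes x≡a | _ | _ | _ = inj₁ (inj₁ x≡a)
  ... | no _ | yes x≡b | _ | _ = inj₁ (inj₂ (inj₁ x≡b))
  ... | no _ | no _ | yes x≡c | _ = inj₁ (inj₂ (inj₂ (inj₁ x≡c)))
  ... | no _ | no _ | no _ | yes x≡d = inj₁ (inj₂ (inj₂ (inj₂ x≡d)))
  ... | no x≢a | no x≢b | no x≢c | no x≢d = inj₂ (x≢a , x≢b , x≢c , x≢d)

  at-corner : ∀ {P : Pt → Set} {a b c d x} → Corner a b c d x → P a × P b × P c × P d → P x
  at-corner (inj₁ refl) (pa , _) = pa
  at-corner (inj₂ (inj₁ refl)) (_ , pb , _) = pb
  at-corner (inj₂ (inj₂ (inj₁ refl))) (_ , _ , pc , _) = pc
  at-corner (inj₂ (inj₂ (inj₂ refl))) (_ , _ , _ , pd) = pd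

  -- The flip replacing ab, cd by bc, da; unlike CenteredFlipAt, this description is invariant
  -- under reversing the flip (Flip-reverse).
  record Flip (X Y : Matching n) (a b c d : Pt) : Set where
    field
      ab>0 : 0 < arc a b
      bc>0 : 0 < arc b c
      cd>0 : 0 < arc c d
      da>0 : 0 < arc d a
      ab≤n : arc a b ≤ n
      bc≤n : arc b c ≤ n
      cd≤n : arc c d ≤ n
      da≤n : arc d a ≤ n
      perimeter : arc a b + arc b c + arc c d + arc d a ≡ N
      X[a]≡b : partner X a ≡ b
      X[c]≡d : partner X c ≡ d
      Y[b]≡c : partner Y b ≡ c
      Y[d]≡a : partner Y d ≡ a
      unchanged : ∀ x → Avoids a b c d x → partner Y x ≡ partner X x
      ¬cross-ab : ∀ x → Avoids a b c d x → ¬ Cross n a b x (partner X x)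
      ¬cross-bc : ∀ x → Avoids a b c d x → ¬ Cross n b c x (partner X x)
      ¬cross-cd : ∀ x → Avoids a b c d x → ¬ Cross n c d x (partner X x)
      ¬cross-da : ∀ x → Avoids a b c d x → ¬ Cross n d a x (partner X x)

  Flip-reverse : ∀ {X Y a b c d} → Flip X Y a b c d → Flip Y X b c d a
  Flip-reverse {X} {Y} {a} {b} {c} {d} f = record
    { ab>0 = bc>0 ; bc>0 = cd>0 ; cd>0 = da>0 ; da>0 = ab>0
    ; ab≤n = bc≤n ; bc≤n = cd≤n ; cd≤n = da≤n ; da≤n = ab≤n
    ; perimeter = trans (sym (rotate (arc a b) (arc b c) (arc c d) (arc d a))) perimeter
    ; X[a]≡b = Y[b]≡c ; X[c]≡d = Y[d]≡a ; Y[b]≡c = X[c]≡d ; Y[d]≡a = X[a]≡b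
    ; unchanged = λ x av → sym (unchanged x (rotate-avoids av))
    ; ¬cross-ab = in-Y b c ¬cross-bc ; ¬cross-bc = in-Y c d ¬cross-cd
    ; ¬cross-cd = in-Y d a ¬cross-da ; ¬cross-da = in-Y a b ¬cross-ab
    }
    where
      open Flip f
      rotate : ∀ p q r s → p + q + r + s ≡ q + r + s + p
      rotate = solve-∀
      rotate-avoids : ∀ {x} → Avoids b c d a x → Avoids a b c d x
      rotate-avoids (x≢b , x≢c , x≢d , x≢a) = x≢a , x≢b , x≢c , x≢d
      in-Y : ∀ p q → (∀ x → Avoids a b c d x → ¬ Cross n p q x (partner X x)) →
             ∀ x → Avoids b c d a x → ¬ Cross n p q x (partner Y x)
      in-Y p q ¬cross x av =
        subst (λ z → ¬ Cross n p q x z) (sym (unchanged x (rotate-avoids av))) (¬cross x (rotate-avoids av))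

  centeredFlipAt⇒Flip : ∀ {X Y a b c d} → IsNCPM X → CenteredFlipAt X Y a b c d → Flip X Y a b c d
  centeredFlipAt⇒Flip {X} {Y} {a} {b} {c} {d} isNCPM
    ( (ab>0 , ab<ac , ac<ad) , X[a]≡b , X[c]≡d , empty , (ab≤n , bc≤n , cd≤n , da≤n)
    , Y[b]≡c , _ , Y[d]≡a , _ , unchanged )
    = record
    { ab>0 = ab>0 ; bc>0 = positive ab+bc≡ac ab<ac ; cd>0 = positive ac+cd≡ad ac<ad
    ; da>0 = positive ad+da≡N (arc<N a d)
    ; ab≤n = ab≤n ; bc≤n = bc≤n ; cd≤n = cd≤n ; da≤n = da≤n
    ; perimeter = trans (cong (λ z → z + arc c d + arc d a) ab+bc≡ac)
                        (trans (cong (_+ arc d a) ac+cd≡ad) ad+da≡N)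
    ; X[a]≡b = X[a]≡b ; X[c]≡d = X[c]≡d ; Y[b]≡c = Y[b]≡c ; Y[d]≡a = Y[d]≡a
    ; unchanged = λ x (x≢a , x≢b , x≢c , x≢d) → unchanged x x≢a x≢b x≢c x≢d
    ; ¬cross-ab = λ x _ → subst (λ z → ¬ Cross n a z x (partner X x)) X[a]≡b (proj₂ isNCPM a x)
    ; ¬cross-bc = λ x _ → proj₁ (empty x)
    ; ¬cross-cd = λ x _ → subst (λ z → ¬ Cross n c z x (partner X x)) X[c]≡d (proj₂ isNCPM c x)
    ; ¬cross-da = λ x _ → proj₂ (empty x)
    }
    where
      ab+bc≡ac : arc a b + arc b c ≡ arc a c
      ab+bc≡ac = arc-split a b c (<⇒≤ ab<ac)
      ac+cd≡ad : arc a c + arc c d ≡ arc a d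
      ac+cd≡ad = arc-split a c d (<⇒≤ ac<ad)
      ad+da≡N : arc a d + arc d a ≡ N
      ad+da≡N = arc-round-trip a d (<-trans ab>0 (<-trans ab<ac ac<ad))
      positive : ∀ {u v w} → u + v ≡ w → u < w → 0 < v
      positive {u} {v} refl u<u+v = +-cancelˡ-< u 0 v (subst (_< u + v) (sym (+-identityʳ u)) u<u+v)

  H⇒Flip : ∀ {X Y} → H n X Y → ∃[ a ] ∃[ b ] ∃[ c ] ∃[ d ] Flip X Y a b c d
  H⇒Flip (isNCPM-X , _ , inj₁ (a , b , c , d , flip)) = a , b , c , d , centeredFlipAt⇒Flip isNCPM-X flip
  H⇒Flip (_ , isNCPM-Y , inj₂ (a , b , c , d , flip)) =
    b , c , d , a , Flip-reverse (centeredFlipAt⇒Flip isNCPM-Y flip)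

  H-sym : ∀ {X Y} → H n X Y → H n Y X
  H-sym (isNCPM-X , isNCPM-Y , flip) = isNCPM-Y , isNCPM-X , swap flip

  module FlipGeometry {X Y : Matching n} {a b c d : Pt} (isNCPM-X : IsNCPM X) (f : Flip X Y a b c d) where

    open Flip f
    open NonCrossingPerfectMatching X isNCPM-X using (involutive)

    ab+bc<N : arc a b + arc b c < N
    ab+bc<N = subst (arc a b + arc b c <_) (trans (sym (+-assoc (arc a b + arc b c) _ _)) perimeter)
                (m<m+n _ (<-≤-trans cd>0 (m≤m+n _ _)))

    ac≡ab+bc : arc a c ≡ arc a b + arc b c
    ac≡ab+bc = arc-+ a b c ab+bc<N

    ad≡ab+bc+cd : arc a d ≡ arc a b + arc b c + arc c d
    ad≡ab+bc+cd = trans (arc-+ a c d (subst (λ z → z + arc c d < N) (sym ac≡ab+bc) ab+bc+cd<N))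
                        (cong (_+ arc c d) ac≡ab+bc)
      where
        ab+bc+cd<N : arc a b + arc b c + arc c d < N
        ab+bc+cd<N = subst (arc a b + arc b c + arc c d <_) perimeter (m<m+n _ da>0)

    ab<ac : arc a b < arc a c
    ab<ac = subst (arc a b <_) (sym ac≡ab+bc) (m<m+n _ bc>0)

    ac<ad : arc a c < arc a d
    ac<ad = subst₂ _<_ (sym ac≡ab+bc) (sym ad≡ab+bc+cd) (m<m+n _ cd>0)

    ab<ad : arc a b < arc a d
    ab<ad = <-trans ab<ac ac<ad

    X[b]≡a : partner X b ≡ a
    X[b]≡a = trans (cong (partner X) (sym X[a]≡b)) (involutive a)

    X[d]≡c : partner X d ≡ c
    X[d]≡c = trans (cong (partner X) (sym X[c]≡d)) (involutive c)

    partner-avoids : ∀ x → Avoids a b c d x → Avoids a b c d (partner X x)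
    partner-avoids x (x≢a , x≢b , x≢c , x≢d) =
      (λ e → x≢b (trans (sym (involutive x)) (trans (cong (partner X) e) X[a]≡b))) ,
      (λ e → x≢a (trans (sym (involutive x)) (trans (cong (partner X) e) X[b]≡a))) ,
      (λ e → x≢d (trans (sym (involutive x)) (trans (cong (partner X) e) X[c]≡d))) ,
      (λ e → x≢c (trans (sym (involutive x)) (trans (cong (partner X) e) X[d]≡c)))

    -- An untouched edge crossing a diagonal would have to cross a side of the empty quadrilateral.
    diagonal-ac-uncrossed : ∀ x → Avoids a b c d x → Inside a c x → Inside a c (partner X x)
    diagonal-ac-uncrossed x av@(_ , x≢b , _) (ax>0 , ax<ac) with <-cmp (arc a x) (arc a b)
    ... | tri< ax<ab _ _ = let (ay>0 , ay<ab) = ¬cross-inside a b x _ (¬cross-ab x av) (ax>0 , ax<ab)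
                           in ay>0 , <-trans ay<ab ab<ac
    ... | tri≈ _ ax≡ab _ = ⊥-elim (x≢b (arc-injective a ax≡ab))
    ... | tri> _ _ ab<ax = let (ab<ay , ay<ac) = inside⇒arc-between a b c _ ab<ac
                                  (¬cross-inside b c x _ (¬cross-bc x av) (arc-between⇒inside a b c x ab<ac ab<ax ax<ac))
                           in <-trans ab>0 ab<ay , ay<ac

    diagonal-bd-uncrossed : ∀ x → Avoids a b c d x → Inside b d x → Inside b d (partner X x)
    diagonal-bd-uncrossed x av@(_ , _ , x≢c , _) x-inside with inside⇒arc-between a b d x ab<ad x-inside
    ... | ab<ax , ax<ad with <-cmp (arc a x) (arc a c)
    ...   | tri< ax<ac _ _ = let (ab<ay , ay<ac) = inside⇒arc-between a b c _ ab<ac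
                                    (¬cross-inside b c x _ (¬cross-bc x av) (arc-between⇒inside a b c x ab<ac ab<ax ax<ac))
                             in arc-between⇒inside a b d _ ab<ad ab<ay (<-trans ay<ac ac<ad)
    ...   | tri≈ _ ax≡ac _ = ⊥-elim (x≢c (arc-injective a ax≡ac))
    ...   | tri> _ _ ac<ax = let (ac<ay , ay<ad) = inside⇒arc-between a c d _ ac<ad
                                    (¬cross-inside c d x _ (¬cross-cd x av) (arc-between⇒inside a c d x ac<ad ac<ax ax<ad))
                             in arc-between⇒inside a b d _ ab<ad (<-trans ab<ac ac<ay) ay<ad

  Symmetric : Matching n → Set
  Symmetric W = ∀ i → partner W (σ i) ≡ σ (partner W i)

  cs⇒symmetric : ∀ {W} → CentrallySymmetric W → Symmetric W
  cs⇒symmetric {W} cs i = toℕ-injective (trans (cs i (σ i) (toℕ-σ i)) (sym (toℕ-σ (partner W i))))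

  symmetric⇒cs : ∀ {W} → Symmetric W → CentrallySymmetric W
  symmetric⇒cs {W} sym-W i j j≡σi = begin
    toℕ (partner W j)        ≡⟨ cong (toℕ ∘ partner W) (toℕ-injective (trans j≡σi (sym (toℕ-σ i)))) ⟩
    toℕ (partner W (σ i))    ≡⟨ cong toℕ (sym-W i) ⟩
    toℕ (σ (partner W i))    ≡⟨ toℕ-σ (partner W i) ⟩
    antipode n (toℕ (partner W i)) ∎
    where open ≡-Reasoning

  -- If the diagonal ac were longer than a half circle, the antipode of a would lie on the side bc,
  -- and the edge from it to the antipode of b would cross that side.
  ¬n<diagonal : 2 ∣ n → ∀ {X Y a b c d} → IsNCPM X → Symmetric X → Flip X Y a b c d → ¬ n < arc a c
  ¬n<diagonal 2∣n {X} {Y} {a} {b} {c} {d} isNCPM-X sym-X f n<ac =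
    ¬cross-bc (σ a) σa-avoids (inj₁ (σa-inside , subst (λ z → ¬ Inside b c z) (sym X[σa]≡σb) σb-outside))
    where
      open Flip f
      open FlipGeometry isNCPM-X f
      open NonCrossingPerfectMatching X isNCPM-X using (no-diameter)
      ab<n : arc a b < n
      ab<n = ≤∧≢⇒< ab≤n (λ e → no-diameter 2∣n a (trans (cong (arc a) X[a]≡b) e))
      not-at-distance-n : ∀ {z} → arc a z ≢ n → σ a ≢ z
      not-at-distance-n az≢n e = az≢n (trans (cong (arc a) (sym e)) (arc-σ a))
      σa-avoids : Avoids a b c d (σ a)
      σa-avoids = σ-irreflexive a , not-at-distance-n (<⇒≢ ab<n) , not-at-distance-n (>⇒≢ n<ac)
                , not-at-distance-n (>⇒≢ (<-trans n<ac ac<ad))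
      σa-inside : Inside b c (σ a)
      σa-inside = arc-between⇒inside a b c (σ a) ab<ac (subst (arc a b <_) (sym (arc-σ a)) ab<n)
                    (subst (_< arc a c) (sym (arc-σ a)) n<ac)
      X[σa]≡σb : partner X (σ a) ≡ σ b
      X[σa]≡σb = trans (sym-X a) (cong σ X[a]≡b)
      σb-outside : ¬ Inside b c (σ b)
      σb-outside σb-inside = <⇒≱ (proj₂ (inside⇒arc-between a b c (σ b) ab<ac σb-inside))
        (subst₂ _≤_ (sym ac≡ab+bc) (sym (arc-σ-< a b ab<n)) (+-monoʳ-≤ (arc a b) bc≤n))

  opposite-corners : 2 ∣ n → ∀ {X Y a b c d} → IsNCPM X → Symmetric X → Flip X Y a b c d →
                     c ≡ σ a × d ≡ σ b
  opposite-corners 2∣n {X} {Y} {a} {b} {c} {d} isNCPM-X sym-X f with <-cmp (arc a c) n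
  ... | tri≈ _ ac≡n _ = c≡σa , (begin
      d                  ≡⟨ X[c]≡d ⟨
      partner X c        ≡⟨ cong (partner X) c≡σa ⟩
      partner X (σ a)    ≡⟨ sym-X a ⟩
      σ (partner X a)    ≡⟨ cong σ X[a]≡b ⟩
      σ b                ∎)
    where
      open ≡-Reasoning
      open Flip f
      c≡σa : c ≡ σ a
      c≡σa = arc-injective a (trans ac≡n (sym (arc-σ a)))
  ... | tri> _ _ n<ac = ⊥-elim (¬n<diagonal 2∣n isNCPM-X sym-X f n<ac)
  ... | tri< ac<n _ _ = ⊥-elim (¬n<diagonal 2∣n isNCPM-X sym-X (Flip-reverse (Flip-reverse f)) n<ca)
    where
      open FlipGeometry isNCPM-X f using (ab<ac)
      open Flip f using (ab>0)
      n<ca : n < arc c a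
      n<ca = +-cancelˡ-< n n (arc c a)
               (subst (_< n + arc c a) (trans (arc-round-trip a c (<-trans ab>0 ab<ac)) N≡n+n)
                 (+-monoˡ-< (arc c a) ac<n))

  OffDiameters : Pt → Pt → Pt → Set
  OffDiameters e f x = (x ≢ e) × (x ≢ f) × (x ≢ σ e) × (x ≢ σ f)

  off-diameter-ends : ∀ {t b z} → (t ≡ b) ⊎ (t ≡ σ b) → z ≢ t → z ≢ σ t → (z ≢ b) × (z ≢ σ b)
  off-diameter-ends (inj₁ refl) z≢t z≢σt = z≢t , z≢σt
  off-diameter-ends {b = b} (inj₂ refl) z≢t z≢σt = (λ e → z≢σt (trans e (sym (σ-involutive b)))) , z≢t

  _≃σ_ : Matching n → Matching n → Set
  W ≃σ V = ∀ x → (partner W x ≡ partner V x) ⊎ (partner W x ≡ σ (partner V x))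

  ≃σ-sym : ∀ {W V} → W ≃σ V → V ≃σ W
  ≃σ-sym W≃V x with W≃V x
  ... | inj₁ e = inj₁ (sym e)
  ... | inj₂ e = inj₂ (trans (sym (σ-involutive _)) (cong σ (sym e)))

  ≃σ-trans : ∀ {U V W} → U ≃σ V → V ≃σ W → U ≃σ W
  ≃σ-trans U≃V V≃W x with U≃V x | V≃W x
  ... | inj₁ e₁ | inj₁ e₂ = inj₁ (trans e₁ e₂)
  ... | inj₁ e₁ | inj₂ e₂ = inj₂ (trans e₁ e₂)
  ... | inj₂ e₁ | inj₁ e₂ = inj₂ (trans e₁ (cong σ e₂))
  ... | inj₂ e₁ | inj₂ e₂ = inj₁ (trans e₁ (trans (cong σ e₂) (σ-involutive _)))

  module SymmetricFlip (2∣n : 2 ∣ n) {X Y : Matching n} {a b c d : Pt}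
                       (isNCPM-X : IsNCPM X) (isNCPM-Y : IsNCPM Y) (sym-X : Symmetric X)
                       (f : Flip X Y a b c d) where

    open Flip f
    open FlipGeometry isNCPM-X f public
    open NonCrossingPerfectMatching X isNCPM-X using (involutive)
    open NonCrossingPerfectMatching Y isNCPM-Y using () renaming (involutive to involutive-Y)

    c≡σa : c ≡ σ a
    c≡σa = proj₁ (opposite-corners 2∣n isNCPM-X sym-X f)

    d≡σb : d ≡ σ b
    d≡σb = proj₂ (opposite-corners 2∣n isNCPM-X sym-X f)

    off⇒avoids : ∀ {x} → OffDiameters a b x → Avoids a b c d x
    off⇒avoids (x≢a , x≢b , x≢σa , x≢σb) =
      x≢a , x≢b , (λ e → x≢σa (trans e c≡σa)) , (λ e → x≢σb (trans e d≡σb))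

    avoids⇒off : ∀ {x} → Avoids a b c d x → OffDiameters a b x
    avoids⇒off (x≢a , x≢b , x≢c , x≢d) =
      x≢a , x≢b , (λ e → x≢c (trans e (sym c≡σa))) , (λ e → x≢d (trans e (sym d≡σb)))

    sameSide-of-uncrossed : ∀ p q → q ≡ σ p →
                            (∀ z → Avoids a b c d z → Inside p q z → Inside p q (partner X z)) →
                            ∀ x → Avoids a b c d x → SameSide p x (partner X x)
    sameSide-of-uncrossed p .(σ p) refl uncrossed x av =
      uncrossed x av , λ h → subst (Half p) (involutive x) (uncrossed (partner X x) (partner-avoids x av) h)

    sides-preserved : ∀ x → OffDiameters a b x → SameSide a x (partner X x) × SameSide b x (partner X x)
    sides-preserved x off = sameSide-of-uncrossed a c c≡σa diagonal-ac-uncrossed x (off⇒avoids off)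
                          , sameSide-of-uncrossed b d d≡σb diagonal-bd-uncrossed x (off⇒avoids off)

    Y[a]≡d : partner Y a ≡ d
    Y[a]≡d = trans (cong (partner Y) (sym Y[d]≡a)) (involutive-Y d)

    Y[c]≡b : partner Y c ≡ b
    Y[c]≡b = trans (cong (partner Y) (sym Y[b]≡c)) (involutive-Y b)

    a≡σc : a ≡ σ c
    a≡σc = trans (sym (σ-involutive a)) (cong σ (sym c≡σa))

    b≡σd : b ≡ σ d
    b≡σd = trans (sym (σ-involutive b)) (cong σ (sym d≡σb))

    Y≃σX : Y ≃σ X
    Y≃σX x with corner? a b c d x
    ... | inj₂ av = inj₁ (unchanged x av)
    ... | inj₁ at = inj₂ (at-corner {P = λ z → partner Y z ≡ σ (partner X z)} at
                      ( trans Y[a]≡d (trans d≡σb (cong σ (sym X[a]≡b)))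
                      , trans Y[b]≡c (trans c≡σa (cong σ (sym X[b]≡a)))
                      , trans Y[c]≡b (trans b≡σd (cong σ (sym X[c]≡d)))
                      , trans Y[d]≡a (trans a≡σc (cong σ (sym X[d]≡c)))))

    corner : ∀ {p p' q q'} → p' ≡ σ p → partner Y p' ≡ q' → partner Y p ≡ q → q' ≡ σ q →
             partner Y (σ p) ≡ σ (partner Y p)
    corner p'≡σp Yp'≡q' Yp≡q q'≡σq =
      trans (cong (partner Y) (sym p'≡σp)) (trans Yp'≡q' (trans q'≡σq (cong σ (sym Yp≡q))))

    Y-symmetric : Symmetric Y
    Y-symmetric x with corner? a b c d x
    ... | inj₁ at = at-corner {P = λ z → partner Y (σ z) ≡ σ (partner Y z)} at
                      ( corner c≡σa Y[c]≡b Y[a]≡d b≡σd , corner d≡σb Y[d]≡a Y[b]≡c a≡σc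
                      , corner a≡σc Y[a]≡d Y[c]≡b d≡σb , corner b≡σd Y[b]≡c Y[d]≡a c≡σa )
    ... | inj₂ av@(x≢a , x≢b , x≢c , x≢d) = begin
        partner Y (σ x)  ≡⟨ unchanged (σ x) σx-avoids ⟩
        partner X (σ x)  ≡⟨ sym-X x ⟩
        σ (partner X x)  ≡⟨ cong σ (unchanged x av) ⟨
        σ (partner Y x)  ∎
      where
        open ≡-Reasoning
        σx-avoids : Avoids a b c d (σ x)
        σx-avoids = (λ e → x≢c (trans (sym (σ-involutive x)) (trans (cong σ e) (sym c≡σa))))
                  , (λ e → x≢d (trans (sym (σ-involutive x)) (trans (cong σ e) (sym d≡σb))))
                  , (λ e → x≢a (σ-injective (trans e c≡σa)))
                  , (λ e → x≢b (σ-injective (trans e d≡σb)))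

  Separated : Matching n → Pt → Pt → Set
  Separated W e f = ∀ x → OffDiameters e f x →
    OffDiameters e f (partner W x) × SameSide e x (partner W x) × SameSide f x (partner W x)

  off-swap : ∀ {e f x} → OffDiameters e f x → OffDiameters f e x
  off-swap (x≢e , x≢f , x≢σe , x≢σf) = x≢f , x≢e , x≢σf , x≢σe

  off-σ : ∀ {e f x} → OffDiameters e f x → OffDiameters (σ e) f x
  off-σ {e} (x≢e , x≢f , x≢σe , x≢σf) =
    x≢σe , x≢f , (λ x≡σσe → x≢e (trans x≡σσe (σ-involutive e))) , x≢σf

  off-σ⁻¹ : ∀ {e f x} → OffDiameters (σ e) f x → OffDiameters e f x
  off-σ⁻¹ {e} (x≢σe , x≢f , x≢σσe , x≢σf) =
    (λ x≡e → x≢σσe (trans x≡e (sym (σ-involutive e)))) , x≢f , x≢σe , x≢σf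

  separated-swap : ∀ {W e f} → Separated W e f → Separated W f e
  separated-swap sep x off with sep x (off-swap off)
  ... | off-y , side-e , side-f = off-swap off-y , side-f , side-e

  separated-σˡ : ∀ {W e f} → Separated W e f → Separated W (σ e) f
  separated-σˡ {W} {e} sep x off with off-σ⁻¹ off
  ... | off₀@(x≢e , _ , x≢σe , _) with sep x off₀
  ...   | off-y@(y≢e , _ , y≢σe , _) , side-e , side-f =
          off-σ off-y , sameSide-σ e x (partner W x) x≢e x≢σe y≢e y≢σe side-e , side-f

  separated-σʳ : ∀ {W e f} → Separated W e f → Separated W e (σ f)
  separated-σʳ {W} {e} {f} sep = separated-swap {W} (separated-σˡ {W} (separated-swap {W} {e} {f} sep))

  flip⇒separated : 2 ∣ n → ∀ {X Y a b c d} → IsNCPM X → IsNCPM Y → Symmetric X → Flip X Y a b c d →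
                   Separated X a b
  flip⇒separated 2∣n isNCPM-X isNCPM-Y sym-X f x off =
    avoids⇒off (partner-avoids x (off⇒avoids off)) , sides-preserved x off
    where open SymmetricFlip 2∣n isNCPM-X isNCPM-Y sym-X f

  separated-≃σ⇒agree : ∀ {U V e f} → U ≃σ V → Separated U e f → Separated V e f →
                       ∀ x → OffDiameters e f x → partner U x ≡ partner V x
  separated-≃σ⇒agree {U} {V} {e} U≃V sep-U sep-V x off with U≃V x | sep-U x off | sep-V x off
  ... | inj₁ Ux≡Vx | _ | _ = Ux≡Vx
  ... | inj₂ Ux≡σVx | _ , side-U , _ | (Vx≢e , _ , Vx≢σe , _) , side-V , _ =
        ⊥-elim (¬sameSide-antipodes e x (partner V x) Vx≢e Vx≢σe side-V (subst (SameSide e x) Ux≡σVx side-U))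

  matching-ext : ∀ {W V : Matching n} → (∀ z → partner W z ≡ partner V z) → W ≡ V
  matching-ext {mkMatching _} {mkMatching _} W≗V = cong mkMatching (Pointwise-≡⇒≡ (ext W≗V))

  -- The four endpoints of the two diameters are matched among themselves: a with t, and σ a with σ t.
  determined : ∀ {W V a b} → IsNCPM W → IsNCPM V → Symmetric W → Symmetric V →
               (∀ x → OffDiameters a b x → partner W x ≡ partner V x) →
               partner W a ≡ partner V a → (partner W a ≡ b) ⊎ (partner W a ≡ σ b) → W ≡ V
  determined {W} {V} {a} {b} isNCPM-W isNCPM-V sym-W sym-V agree-off W[a]≡V[a] t-on-diameter =
    matching-ext agree
    where
      open NonCrossingPerfectMatching W isNCPM-W using () renaming (involutive to involutive-W)
      open NonCrossingPerfectMatching V isNCPM-V using () renaming (involutive to involutive-V)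
      t : Pt
      t = partner W a
      W[t]≡V[t] : partner W t ≡ partner V t
      W[t]≡V[t] = trans (involutive-W a) (trans (sym (involutive-V a)) (cong (partner V) (sym W[a]≡V[a])))
      σ-image : ∀ p → partner W p ≡ partner V p → partner W (σ p) ≡ partner V (σ p)
      σ-image p W[p]≡V[p] = trans (sym-W p) (trans (cong σ W[p]≡V[p]) (sym (sym-V p)))
      agree : ∀ z → partner W z ≡ partner V z
      agree z with corner? a t (σ a) (σ t) z
      ... | inj₁ at = at-corner {P = λ z → partner W z ≡ partner V z} at
                        (W[a]≡V[a] , W[t]≡V[t] , σ-image a W[a]≡V[a] , σ-image t W[t]≡V[t])
      ... | inj₂ (z≢a , z≢t , z≢σa , z≢σt) =
            let (z≢b , z≢σb) = off-diameter-ends t-on-diameter z≢t z≢σt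
            in agree-off z (z≢a , z≢b , z≢σa , z≢σb)

  moved⇒corner : ∀ {X Y a b c d x} → Flip X Y a b c d → partner X x ≢ partner Y x → Corner a b c d x
  moved⇒corner {a = a} {b} {c} {d} {x} f moved with corner? a b c d x
  ... | inj₁ at = at
  ... | inj₂ av = ⊥-elim (moved (sym (Flip.unchanged f x av)))

  flip⇒corners-separated : 2 ∣ n → ∀ {X Y a b c d} → IsNCPM X → IsNCPM Y → Symmetric X → Flip X Y a b c d →
    Separated X a (partner X a) × Separated X b (partner X b) ×
    Separated X c (partner X c) × Separated X d (partner X d)
  flip⇒corners-separated 2∣n {X} {Y} {a} {b} {c} {d} isNCPM-X isNCPM-Y sym-X f =
      subst (Separated X a) (sym X[a]≡b) sep-ab
    , subst (Separated X b) (sym X[b]≡a) (separated-swap {X} sep-ab)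
    , subst (Separated X c) (sym X[c]≡d) sep-cd
    , subst (Separated X d) (sym X[d]≡c) (separated-swap {X} sep-cd)
    where
      open Flip f
      open SymmetricFlip 2∣n {X} {Y} isNCPM-X isNCPM-Y sym-X f
      sep-ab : Separated X a b
      sep-ab = flip⇒separated 2∣n isNCPM-X isNCPM-Y sym-X f
      sep-cd : Separated X c d
      sep-cd = subst₂ (Separated X) (sym c≡σa) (sym d≡σb) (separated-σʳ {X} (separated-σˡ {X} sep-ab))

  separated-toward-diameter : ∀ {W a b t} → (t ≡ b) ⊎ (t ≡ σ b) → Separated W a t → Separated W a b
  separated-toward-diameter (inj₁ refl) sep = sep
  separated-toward-diameter {W} {a} {b} (inj₂ refl) sep =
    subst (Separated W a) (σ-involutive b) (separated-σʳ {W} sep)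

  -- The flip component of a centrally symmetric matching

  module FlipComponent (2∣n : 2 ∣ n) (M : Matching n) where

    Admissible : Matching n → Set
    Admissible W = IsNCPM W × Symmetric W × W ≃σ M

    admissible-step : ∀ {X Y} → Admissible X → H n X Y → Admissible Y
    admissible-step {X} {Y} (isNCPM-X , sym-X , X≃M) X~Y@(_ , isNCPM-Y , _) with H⇒Flip X~Y
    ... | _ , _ , _ , _ , f = isNCPM-Y , Y-symmetric , ≃σ-trans {Y} {X} {M} Y≃σX X≃M
      where open SymmetricFlip 2∣n {X} {Y} isNCPM-X isNCPM-Y sym-X f

    admissible-star : ∀ {A B} → Star (H n) A B → Admissible A → Admissible B
    admissible-star ε adm-A = adm-A
    admissible-star {A} (_◅_ {j = X} A~X X⇝B) adm-A = admissible-star X⇝B (admissible-step {A} {X} adm-A A~X)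

    moving⇒separated : ∀ {u u' a} → Admissible u → H n u u' → partner u a ≢ partner u' a →
                       Separated u a (partner u a)
    moving⇒separated {u} {u'} {a} (isNCPM-u , sym-u , _) u~u'@(_ , isNCPM-u' , _) moved =
      at-flip (proj₂ (proj₂ (proj₂ (proj₂ (H⇒Flip u~u')))))
      where
        at-flip : ∀ {a' b' c' d'} → Flip u u' a' b' c' d' → Separated u a (partner u a)
        at-flip g = at-corner {P = λ z → Separated u z (partner u z)} (moved⇒corner g moved)
                      (flip⇒corners-separated 2∣n isNCPM-u isNCPM-u' sym-u g)

    -- u agrees with X₀ up to σ; off the diameters through a and b both keep every edge on one side of
    -- them, which rules out σ there, so u is pinned down by u a ∈ {b , σ b} as X₀ or X₁.
    moving-flip-unique : ∀ {X₀ X₁ a b c d u u'} → Admissible X₀ → IsNCPM X₁ → Flip X₀ X₁ a b c d →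
                         Admissible u → H n u u' → partner u a ≢ partner u' a → (u ≡ X₀) ⊎ (u ≡ X₁)
    moving-flip-unique {X₀} {X₁} {a} {b} {c} {d} {u} {u'} (isNCPM-X₀ , sym-X₀ , X₀≃M) isNCPM-X₁ f
                       adm-u@(isNCPM-u , sym-u , u≃M) u~u' moved = conclude u-on-diameter
      where
        open Flip f
        open SymmetricFlip 2∣n isNCPM-X₀ isNCPM-X₁ sym-X₀ f
        u≃X₀ : u ≃σ X₀
        u≃X₀ = ≃σ-trans {u} {M} {X₀} u≃M (≃σ-sym {X₀} {M} X₀≃M)
        u-on-diameter : (partner u a ≡ b) ⊎ (partner u a ≡ σ b)
        u-on-diameter = map⊎ (λ e → trans e X[a]≡b) (λ e → trans e (cong σ X[a]≡b)) (u≃X₀ a)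
        agree-X₀ : ∀ x → OffDiameters a b x → partner u x ≡ partner X₀ x
        agree-X₀ = separated-≃σ⇒agree {u} {X₀} u≃X₀
                     (separated-toward-diameter {u} u-on-diameter (moving⇒separated {u} {u'} adm-u u~u' moved))
                     (flip⇒separated 2∣n {X₀} {X₁} isNCPM-X₀ isNCPM-X₁ sym-X₀ f)
        agree-X₁ : ∀ x → OffDiameters a b x → partner u x ≡ partner X₁ x
        agree-X₁ x off = trans (agree-X₀ x off) (sym (unchanged x (off⇒avoids off)))
        conclude : (partner u a ≡ b) ⊎ (partner u a ≡ σ b) → (u ≡ X₀) ⊎ (u ≡ X₁)
        conclude (inj₁ u[a]≡b) =
          inj₁ (determined isNCPM-u isNCPM-X₀ sym-u sym-X₀ agree-X₀ (trans u[a]≡b (sym X[a]≡b)) (inj₁ u[a]≡b))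
        conclude (inj₂ u[a]≡σb) =
          inj₂ (determined isNCPM-u isNCPM-X₁ sym-u Y-symmetric agree-X₁
                  (trans u[a]≡σb (trans (sym d≡σb) (sym Y[a]≡d))) (inj₂ u[a]≡σb))

    module AroundFlip {v w₁ : Matching n} {a b c d : Pt}
                      (adm-v : Admissible v) (isNCPM-w₁ : IsNCPM w₁) (f : Flip v w₁ a b c d) where

      Fresh : Matching n → Set
      Fresh u = Admissible u × u ≢ v × u ≢ w₁

      partner-fixed : ∀ {u u'} → Fresh u → H n u u' → partner u a ≡ partner u' a
      partner-fixed {u} {u'} (adm-u , u≢v , u≢w₁) u~u' with partner u a ≟ᶠ partner u' a
      ... | yes fixed = fixed
      ... | no moved =
            ⊥-elim ([ u≢v , u≢w₁ ]′ (moving-flip-unique {v} {w₁} {u = u} {u'} adm-v isNCPM-w₁ f adm-u u~u' moved))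

      partner-fixed-along : ∀ s x xs z → Chain (H n) (s ∷ x ∷ xs ++ [ z ]) → All Fresh (x ∷ xs) →
                            partner s a ≡ partner z a
      partner-fixed-along s x [] z (s~x , x~z , _) (fresh-x ∷ []) =
        trans (sym (partner-fixed {x} {s} fresh-x (H-sym {s} {x} s~x))) (partner-fixed {x} {z} fresh-x x~z)
      partner-fixed-along s x (y ∷ xs) z (s~x , chain) (fresh-x ∷ fresh-xs) =
        trans (sym (partner-fixed {x} {s} fresh-x (H-sym {s} {x} s~x))) (partner-fixed-along x y xs z chain fresh-xs)

    -- Around a cycle through the flip v → w₁ the partner of a would have to return from σ b to b.
    no-cycle : Admissible M → ∀ v ws → IsCycle (H n) v ws → All (Star (H n) M) (v ∷ ws) → ⊥
    no-cycle _ v [] (() , _) _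
    no-cycle _ v (w₁ ∷ []) (s≤s () , _) _
    no-cycle adm-M v (w₁ ∷ w₂ ∷ rest) (_ , (v∉ws ∷ w₁∉rest ∷ _) , v~w₁ , chain) (M⇝v ∷ _ ∷ M⇝rest)
      with H⇒Flip v~w₁
    ... | a , b , c , d , f = σ-irreflexive b (begin
        σ b             ≡⟨ d≡σb ⟨
        d               ≡⟨ Y[a]≡d ⟨
        partner w₁ a    ≡⟨ partner-fixed-along w₁ w₂ rest v chain fresh ⟩
        partner v a     ≡⟨ X[a]≡b ⟩
        b               ∎)
      where
        open ≡-Reasoning
        adm-v : Admissible v
        adm-v = admissible-star M⇝v adm-M
        isNCPM-w₁ : IsNCPM w₁
        isNCPM-w₁ = proj₁ (proj₂ v~w₁)
        open Flip f
        open SymmetricFlip 2∣n {v} {w₁} (proj₁ adm-v) isNCPM-w₁ (proj₁ (proj₂ adm-v)) f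
        open AroundFlip {v} {w₁} adm-v isNCPM-w₁ f
        fresh : All Fresh (w₂ ∷ rest)
        fresh = All.zipWith (λ (adm , v≢u , w₁≢u) → adm , ≢-sym v≢u , ≢-sym w₁≢u)
                  (All.map (λ M⇝u → admissible-star M⇝u adm-M) M⇝rest , All.zip (All.tail v∉ws , w₁∉rest))

lemma11 : (n : ℕ) → 2 ∣ n → 2 ≤ n →
    (M : Matching n) → IsNCPM M → CentrallySymmetric M →
    (∀ (M' : Matching n) → Star (H n) M M' → CentrallySymmetric M') ×
    (∀ (v : Matching n) ws → IsCycle (H n) v ws → All (Star (H n) M) (v ∷ ws) → ⊥)
lemma11 n 2∣n 2≤n M isNCPM-M cs-M = component-symmetric , no-cycle admissible-M
  where
    open Circle n (≤-trans (s≤s z≤n) 2≤n)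
    open FlipComponent 2∣n M
    admissible-M : Admissible M
    admissible-M = isNCPM-M , cs⇒symmetric {M} cs-M , (λ _ → inj₁ refl)
    component-symmetric : ∀ M' → Star (H n) M M' → CentrallySymmetric M'
    component-symmetric M' M⇝M' =
      symmetric⇒cs {M'} (proj₁ (proj₂ (admissible-star {M} {M'} M⇝M' admissible-M)))
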